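{- Let $T$ be a complete first-order theory. Then $T$ has BTP if and only if there exist a formula $\varphi(x,y)$, parameters $(a_\eta)_{\eta\in\omega^{<\omega}}$, and $k<\omega$ such that (i) $\{\varphi(x,a_\eta)\}_{\eta\in X}$ is consistent for any strict left-leaning path $X$, (ii) $\{\varphi(x,a_\eta)\}_{\eta\in X}$ is $k$-inconsistent for any strict right-veering path $X$, (iii) $\{\varphi(x,a_\eta)\}_{\eta\in X}$ is $k$-inconsistent for any direct sibling set $X$.
   Context: On $\omega^{<\omega}$: $\eta\unlhd\nu$ means $\eta$ is an initial segment of $\nu$; $^\frown$ is concatenation; $(j)$ is the length-one sequence with value $j$; for nonempty $\eta$, $t(\eta)$ is its last entry and $\eta^-$ is $\eta$ with the last entry removed. For $X\subseteq\omega^{<\omega}$ with $\emptyset\notin X$ and an enumeration $\{\eta_i\}_{i<\mu}$ ($\mu$ a cardinal), required for all $i$ (with $i+1<\mu$): - left-leaning path: $\eta_i^{ -\frown}(j)\lhd\eta_{i+1}$ for some $j\le t(\eta_i)$; - right-veering path: $\eta_i^{ -\frown}(j)\unlhd\eta_{i+1}$ for some $j>t(\eta_i)$; - strict left-leaning path: $\eta_i^{ -\frown}(j)\lhd\eta_{i+1}$ for some $j<t(\eta_i)$; - strict right-veering path: $\eta_i^{ -\frown}(j)\lhd\eta_{i+1}$ for some $j>t(\eta_i)$; - direct sibling set: $\eta_i^{ -\frown}(j)=\eta_{i+1}$ for some $j>t(\eta_i)$. $T$ has BTP if there are $\varphi(x,y)$, $(a_\eta)_{\eta\in\omega^{<\omega}}$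 and $k<\omega$ such that $\{\varphi(x,a_\eta)\}_{\eta\in X}$ is consistent for every left-leaning path $X$ and $k$-inconsistent for every right-veering path $X$. -}

module Defs where

open import Data.Nat using (ℕ; zero; suc; _+_; _≤_; _<_; _>_)
open import Data.Fin using (Fin; toℕ)
open import Data.List using (List; []; _∷_; _++_; _∷ʳ_)
open import Data.Product using (Σ; ∃; _×_; _,_)
open import Data.Sum using (_⊎_)
open import Data.Empty using (⊥)
open import Data.Unit using (⊤)
open import Relation.Nullary using (¬_)
open import Relation.Binary.PropositionalEquality using (_≡_; _≢_)
open import Function.Definitions using (Injective)
import Data.Vec.Functional as V

record Language : Set₁ where
  field
    Func : ℕ → Set
    Rel  : ℕ → Set

module _ (L : Language) where
  open Language L

  data Term (n : ℕ) : Set where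
    var  : Fin n → Term n
    func : ∀ {a} → Func a → (Fin a → Term n) → Term n

  data Formula (n : ℕ) : Set where
    ⊤' ⊥'          : Formula n
    _≐_            : Term n → Term n → Formula n
    rel            : ∀ {a} → Rel a → (Fin a → Term n) → Formula n
    ¬'_            : Formula n → Formula n
    _∧'_ _∨'_ _⇒'_ : Formula n → Formula n → Formula n
    ∀' ∃'          : Formula (suc n) → Formula n

  Sentence : Set
  Sentence = Formula 0

  Theory : Set₁
  Theory = Sentence → Set

  record Structure : Set₁ where
    field
      Carrier   : Set
      inhabited : Carrier
      funcᴹ     : ∀ {a} → Func a → (Fin a → Carrier) → Carrier
      relᴹ      : ∀ {a} → Rel a → (Fin a → Carrier) → Set

module _ {L : Language} (M : Structure L) where
  open Structure M

  eval : ∀ {n} → Term L n → (Fin n → Carrier) → Carrier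
  eval (var i)     ρ = ρ i
  eval (func f ts) ρ = funcᴹ f (λ i → eval (ts i) ρ)

  Sat : ∀ {n} → Formula L n → (Fin n → Carrier) → Set
  Sat ⊤'         ρ = ⊤
  Sat ⊥'         ρ = ⊥
  Sat (s ≐ t)    ρ = eval s ρ ≡ eval t ρ
  Sat (rel R ts) ρ = relᴹ R (λ i → eval (ts i) ρ)
  Sat (¬' φ)     ρ = ¬ Sat φ ρ
  Sat (φ ∧' ψ)   ρ = Sat φ ρ × Sat ψ ρ
  Sat (φ ∨' ψ)   ρ = Sat φ ρ ⊎ Sat ψ ρ
  Sat (φ ⇒' ψ)   ρ = Sat φ ρ → Sat ψ ρ
  Sat (∀' φ)     ρ = (c : Carrier) → Sat φ (c V.∷ ρ)
  Sat (∃' φ)     ρ = Σ Carrier λ c → Sat φ (c V.∷ ρ)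

  _⊨_ : Sentence L → Set
  _⊨_ σ = Sat σ (λ ())

  IsModel : Theory L → Set
  IsModel T = ∀ σ → T σ → _⊨_ σ

Complete : {L : Language} → Theory L → Set₁
Complete {L} T =
  (Σ (Structure L) λ M → IsModel M T) ×
  (∀ σ → (∀ (M : Structure L) → IsModel M T → M ⊨ σ)
       ⊎ (∀ (M : Structure L) → IsModel M T → M ⊨ (¬' σ)))

Seq : Set
Seq = List ℕ

_⊴_ : Seq → Seq → Set
η ⊴ ν = Σ Seq λ s → η ++ s ≡ ν

_◁_ : Seq → Seq → Set
η ◁ ν = Σ Seq λ s → (s ≢ []) × (η ++ s ≡ ν)

-- Relations between consecutive elements η = η_i, ν = η_{i+1}.
-- In each, η is written as ρ ∷ʳ t, so ρ = η⁻ and t = t(η).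
LeftLeaning : Seq → Seq → Set
LeftLeaning η ν = Σ Seq λ ρ → Σ ℕ λ t → Σ ℕ λ j →
  (η ≡ ρ ∷ʳ t) × (j ≤ t) × ((ρ ∷ʳ j) ◁ ν)

RightVeering : Seq → Seq → Set
RightVeering η ν = Σ Seq λ ρ → Σ ℕ λ t → Σ ℕ λ j →
  (η ≡ ρ ∷ʳ t) × (j > t) × ((ρ ∷ʳ j) ⊴ ν)

StrictLeftLeaning : Seq → Seq → Set
StrictLeftLeaning η ν = Σ Seq λ ρ → Σ ℕ λ t → Σ ℕ λ j →
  (η ≡ ρ ∷ʳ t) × (j < t) × ((ρ ∷ʳ j) ◁ ν)

StrictRightVeering : Seq → Seq → Set
StrictRightVeering η ν = Σ Seq λ ρ → Σ ℕ λ t → Σ ℕ λ j →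
  (η ≡ ρ ∷ʳ t) × (j > t) × ((ρ ∷ʳ j) ◁ ν)

DirectSibling : Seq → Seq → Set
DirectSibling η ν = Σ Seq λ ρ → Σ ℕ λ t → Σ ℕ λ j →
  (η ≡ ρ ∷ʳ t) × (j > t) × ((ρ ∷ʳ j) ≡ ν)

-- cardinals μ ≤ ω (the only possible sizes of subsets of ω^{<ω})
data Card : Set where
  fin : ℕ → Card
  ω   : Card

Idx : Card → Set
Idx (fin n) = Fin n
Idx ω       = ℕ

idx→ℕ : ∀ {μ} → Idx μ → ℕ
idx→ℕ {fin n} i = toℕ i
idx→ℕ {ω}     i = i

-- An enumeration {η_i}_{i<μ} of a set X ⊆ ω^{<ω} with ∅ ∉ X;
-- X is the range of `elt`.
record Enumeration : Set where
  field
    μ        : Card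
    elt      : Idx μ → Seq
    injec    : Injective _≡_ _≡_ elt
    nonempty : ∀ i → elt i ≢ []
open Enumeration public

IsPath : (Seq → Seq → Set) → Enumeration → Set
IsPath R E = ∀ i j → idx→ℕ {μ E} j ≡ suc (idx→ℕ {μ E} i) → R (elt E i) (elt E j)

-- Consistency of {φ(x, a_η)}_{η ∈ X} inside a model N of T,
-- with x an nx-tuple and y an ny-tuple; φ has free variables x ++ y.

module _ {L : Language} (N : Structure L) {nx ny : ℕ}
         (φ : Formula L (nx + ny))
         (a : Seq → Fin ny → Structure.Carrier N) where
  open Structure N

  Realises : (Fin nx → Carrier) → Seq → Set
  Realises b η = Sat N φ (b V.++ a η)

  ConsistentOn : Enumeration → Set
  ConsistentOn E = ∀ (n : ℕ) (f : Fin n → Idx (μ E)) →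
    Σ (Fin nx → Carrier) λ b → ∀ l → Realises b (elt E (f l))

  KInconsistentOn : ℕ → Enumeration → Set
  KInconsistentOn k E = ∀ (f : Fin k → Idx (μ E)) → Injective _≡_ _≡_ f →
    ∀ (b : Fin nx → Carrier) → ¬ (∀ l → Realises b (elt E (f l)))

HasBTP : {L : Language} → Theory L → Set₁
HasBTP {L} T =
  Σ (Structure L) λ N → IsModel N T ×
  Σ ℕ λ nx → Σ ℕ λ ny → Σ (Formula L (nx + ny)) λ φ →
  Σ (Seq → Fin ny → Structure.Carrier N) λ a → Σ ℕ λ k →
    (∀ E → IsPath LeftLeaning E → ConsistentOn N φ a E) ×
    (∀ E → IsPath RightVeering E → KInconsistentOn N φ a k E)

StrictBTPWitness : {L : Language} → Theory L → Set₁
StrictBTPWitness {L} T =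
  Σ (Structure L) λ N → IsModel N T ×
  Σ ℕ λ nx → Σ ℕ λ ny → Σ (Formula L (nx + ny)) λ φ →
  Σ (Seq → Fin ny → Structure.Carrier N) λ a → Σ ℕ λ k →
    (∀ E → IsPath StrictLeftLeaning E → ConsistentOn N φ a E) ×
    (∀ E → IsPath StrictRightVeering E → KInconsistentOn N φ a k E) ×
    (∀ E → IsPath DirectSibling E → KInconsistentOn N φ a k E)

-- Strict left-leaning paths are left-leaning, and strict right-veering paths and direct
-- sibling sets are right-veering, which gives one direction.
--
-- For the other, re-index the tree by  spread, which replaces each interior entry j of a
-- node by 2j+1 and its last entry t by 2t+2, and use the parameters a ∘ spread. As j ≤ t
-- implies 2j+1 < 2t+2, spread maps left-leaning paths to strict left-leaning ones. For a
-- right-veering path we get k²-inconsistency: its members are pairwise comparable in the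
-- right-veering order, which never shortens a node, so any k² of them contain k of equal
-- length or k of pairwise distinct lengths. Comparable nodes of equal length are siblings,
-- so their images lie in the direct sibling set of one node. Nodes of distinct lengths,
-- sorted by length, are proper right-veering extensions of one another, and as t < j implies
-- 2t+2 < 2j+1 their images form a strict right-veering path.
module Submission where

open import Defs

open import Data.Empty using (⊥-elim)
open import Data.Fin using (Fin; toℕ; fromℕ<; inject≤)
import Data.Fin.Properties as Fin
open import Data.List
  using (List; []; _∷_; _++_; _∷ʳ_; [_]; length; lookup; map; filter; allFin; initLast; _∷ʳ′_)
open import Data.List.Properties
  using ( ∷-injective; ∷ʳ-injective; ∷ʳ-injectiveˡ; ∷ʳ-injectiveʳ; ++-assoc; ++-identityʳ; ++-conicalʳ
        ; length-++; length-++-≤ˡ; length-map; length-tabulate; map-++; map-injective)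
open import Data.List.Membership.Propositional.Properties using (∈-lookup)
open import Data.List.Relation.Binary.Permutation.Propositional using (_↭_; ↭-sym; ↭⇒↭ₛ)
open import Data.List.Relation.Binary.Permutation.Propositional.Properties using (All-resp-↭; ↭-length)
open import Data.List.Relation.Binary.Sublist.Propositional as Sublist using (_⊆_; ⊆-trans)
open import Data.List.Relation.Binary.Sublist.Propositional.Properties using (All-resp-⊆; filter-⊆)
open import Data.List.Relation.Unary.All as All using (All; []; _∷_)
import Data.List.Relation.Unary.All.Properties as All
open import Data.List.Relation.Unary.AllPairs as AllPairs using (AllPairs; []; _∷_)
import Data.List.Relation.Unary.AllPairs.Properties as AllPairs
open import Data.List.Relation.Unary.Linked as Linked using (Linked; []; [-]; _∷_)
import Data.List.Relation.Unary.Linked.Properties as Linked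
open import Data.List.Relation.Unary.Unique.Propositional using (Unique)
import Data.List.Relation.Unary.Unique.Propositional.Properties as Unique
open import Data.Nat using (ℕ; zero; suc; _+_; _*_; _≤_; _<_; z≤n; s≤s; _≟_; _≤?_)
open import Data.Nat.Properties
open import Data.Product as Product using (Σ; ∃-syntax; _×_; _,_; proj₁)
open import Data.Sum using (_⊎_; inj₁; inj₂)
open import Function using (_∘_; id)
open import Function.Definitions using (Injective)
open import Relation.Binary using (tri<; tri≈; tri>)
import Relation.Binary.Construct.On as On
open import Relation.Binary.PropositionalEquality
  using (_≡_; _≢_; refl; sym; trans; cong; cong₂; subst; ≢-sym; resp₂; setoid; module ≡-Reasoning)
open import Relation.Nullary using (¬_; yes; no; contradiction)
open import Relation.Unary using (Decidable)
open import Relation.Unary.Properties using (∁?)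

open import Data.List.Relation.Binary.Permutation.Setoid.Properties (setoid Seq) using (AllPairs-resp-↭)
open import Data.List.Sort (On.decTotalOrder ≤-decTotalOrder (length {A = ℕ}))
  using (sort; sort-↭; sort-↗)

interior terminal : ℕ → ℕ
interior j = suc (2 * j)
terminal t = suc (suc (2 * t))

spread : Seq → Seq
spread []                = []
spread (t ∷ [])          = terminal t ∷ []
spread (j ∷ η@(_ ∷ _))   = interior j ∷ spread η

interior<terminal : ∀ {j t} → j ≤ t → interior j < terminal t
interior<terminal j≤t = s≤s (s≤s (*-monoʳ-≤ 2 j≤t))

terminal<interior : ∀ {t j} → t < j → terminal t < interior j
terminal<interior {t} {j} t<j = s≤s (subst (_≤ 2 * j) (*-suc 2 t) (*-monoʳ-≤ 2 t<j))

interior-injective : Injective _≡_ _≡_ interior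
interior-injective eq = *-cancelˡ-≡ _ _ 2 (suc-injective eq)

terminal-injective : Injective _≡_ _≡_ terminal
terminal-injective eq = interior-injective (suc-injective eq)

∷ʳ-≢[] : ∀ (ρ : Seq) t → ρ ∷ʳ t ≢ []
∷ʳ-≢[] ρ t eq with ++-conicalʳ ρ [ t ] eq
... | ()

spread-∷ : ∀ j {η} → η ≢ [] → spread (j ∷ η) ≡ interior j ∷ spread η
spread-∷ j {[]}    η≢[] = ⊥-elim (η≢[] refl)
spread-∷ j {_ ∷ _} _    = refl

spread-++ : ∀ ρ {η} → η ≢ [] → spread (ρ ++ η) ≡ map interior ρ ++ spread η
spread-++ []      η≢[] = refl
spread-++ (j ∷ ρ) η≢[] =
  trans (spread-∷ j (η≢[] ∘ ++-conicalʳ ρ _)) (cong (interior j ∷_) (spread-++ ρ η≢[]))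

spread-∷ʳ : ∀ ρ t → spread (ρ ∷ʳ t) ≡ map interior ρ ∷ʳ terminal t
spread-∷ʳ ρ t = spread-++ ρ (λ ())

spread-extension : ∀ ρ j {s} → s ≢ [] →
                   spread ((ρ ∷ʳ j) ++ s) ≡ (map interior ρ ∷ʳ interior j) ++ spread s
spread-extension ρ j {s} s≢[] = begin
  spread ((ρ ∷ʳ j) ++ s)                      ≡⟨ spread-++ (ρ ∷ʳ j) s≢[] ⟩
  map interior (ρ ∷ʳ j) ++ spread s           ≡⟨ cong (_++ spread s) (map-++ interior ρ [ j ]) ⟩
  (map interior ρ ∷ʳ interior j) ++ spread s  ∎
  where open ≡-Reasoning

spread-≢[] : ∀ {η} → η ≢ [] → spread η ≢ []
spread-≢[] {η} η≢[] with initLast η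
... | []      = ⊥-elim (η≢[] refl)
... | ρ ∷ʳ′ t = subst (_≢ []) (sym (spread-∷ʳ ρ t)) (∷ʳ-≢[] _ _)

spread-injective : Injective _≡_ _≡_ spread
spread-injective {η} {ν} eq with initLast η | initLast ν
... | []      | []        = refl
... | []      | ρ′ ∷ʳ′ t′ = ⊥-elim (spread-≢[] (∷ʳ-≢[] ρ′ t′) (sym eq))
... | ρ ∷ʳ′ t | []        = ⊥-elim (spread-≢[] (∷ʳ-≢[] ρ t) eq)
... | ρ ∷ʳ′ t | ρ′ ∷ʳ′ t′
  with ∷ʳ-injective _ _ (trans (sym (spread-∷ʳ ρ t)) (trans eq (spread-∷ʳ ρ′ t′)))
...   | ρ≡ρ′ , t≡t′ = cong₂ _∷ʳ_ (map-injective interior-injective ρ≡ρ′) (terminal-injective t≡t′)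

strictLeftLeaning⇒leftLeaning : ∀ {η ν} → StrictLeftLeaning η ν → LeftLeaning η ν
strictLeftLeaning⇒leftLeaning (ρ , t , j , eq , j<t , ρj◁ν) = ρ , t , j , eq , <⇒≤ j<t , ρj◁ν

strictRightVeering⇒rightVeering : ∀ {η ν} → StrictRightVeering η ν → RightVeering η ν
strictRightVeering⇒rightVeering (ρ , t , j , eq , t<j , s , _ , ρj++s≡ν) =
  ρ , t , j , eq , t<j , s , ρj++s≡ν

directSibling⇒rightVeering : ∀ {η ν} → DirectSibling η ν → RightVeering η ν
directSibling⇒rightVeering (ρ , t , j , eq , t<j , ρj≡ν) =
  ρ , t , j , eq , t<j , [] , trans (++-identityʳ _) ρj≡ν

⊴-trans : ∀ {η ν ξ} → η ⊴ ν → ν ⊴ ξ → η ⊴ ξ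
⊴-trans {η} (s , refl) (s′ , refl) = s ++ s′ , sym (++-assoc η s s′)

⊴-∷ʳ⁻ : ∀ η ρ {t} → η ⊴ (ρ ∷ʳ t) → η ≡ ρ ∷ʳ t ⊎ η ⊴ ρ
⊴-∷ʳ⁻ []          ρ       _ = inj₂ (ρ , refl)
⊴-∷ʳ⁻ (j ∷ [])    []      (s , eq) with refl ← eq = inj₁ refl
⊴-∷ʳ⁻ (j ∷ _ ∷ _) []      (s , ())
⊴-∷ʳ⁻ (j ∷ η)     (i ∷ ρ) (s , eq) with refl , eq′ ← ∷-injective eq | ⊴-∷ʳ⁻ η ρ (s , eq′)
... | inj₁ refl       = inj₁ refl
... | inj₂ (s′ , eq″) = inj₂ (s′ , cong (j ∷_) eq″)

⊴-sameLength : ∀ {η ν} → η ⊴ ν → length η ≡ length ν → η ≡ ν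
⊴-sameLength {η} ([]    , refl) _   = sym (++-identityʳ η)
⊴-sameLength {η} (_ ∷ _ , refl) len = contradiction (sym (trans len (length-++ η))) (m+1+n≢m _)

length-∷ʳ-cong : ∀ ρ {j t : ℕ} → length (ρ ∷ʳ j) ≡ length (ρ ∷ʳ t)
length-∷ʳ-cong ρ = trans (length-++ ρ) (sym (length-++ ρ))

RightVeering-irreflexive : ∀ {η} → ¬ RightVeering η η
RightVeering-irreflexive (ρ , t , j , refl , t<j , ρj⊴ρt)
  with ∷ʳ-injectiveʳ ρ ρ (⊴-sameLength ρj⊴ρt (length-∷ʳ-cong ρ))
... | refl = <-irrefl refl t<j

RightVeering-trans : ∀ {η ν ξ} → RightVeering η ν → RightVeering ν ξ → RightVeering η ξ
RightVeering-trans (ρ , t , j , refl , t<j , ρj⊴ν) (ρ′ , t′ , j′ , refl , t′<j′ , ρ′j′⊴ξ)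
  with ⊴-∷ʳ⁻ (ρ ∷ʳ j) ρ′ ρj⊴ν
... | inj₁ eq with refl , refl ← ∷ʳ-injective ρ ρ′ eq =
  ρ , t , j′ , refl , <-trans t<j t′<j′ , ρ′j′⊴ξ
... | inj₂ ρj⊴ρ′ =
  ρ , t , j , refl , t<j , ⊴-trans ρj⊴ρ′ (⊴-trans ([ j′ ] , refl) ρ′j′⊴ξ)

RightVeering-length : ∀ {η ν} → RightVeering η ν → length η ≤ length ν
RightVeering-length (ρ , t , j , refl , _ , s , refl) =
  subst (_≤ length ((ρ ∷ʳ j) ++ s)) (length-∷ʳ-cong ρ) (length-++-≤ˡ (ρ ∷ʳ j))

Comparable : Seq → Seq → Set
Comparable η ν = RightVeering η ν ⊎ RightVeering ν η

Comparable-sym : ∀ {η ν} → Comparable η ν → Comparable ν η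
Comparable-sym (inj₁ rv) = inj₂ rv
Comparable-sym (inj₂ rv) = inj₁ rv

Comparable⇒≢ : ∀ {η ν} → Comparable η ν → η ≢ ν
Comparable⇒≢ (inj₁ rv) refl = RightVeering-irreflexive rv
Comparable⇒≢ (inj₂ rv) refl = RightVeering-irreflexive rv

Comparable-shorter : ∀ {η ν} → Comparable η ν → length η < length ν → RightVeering η ν
Comparable-shorter (inj₁ rv) _   = rv
Comparable-shorter (inj₂ rv) η<ν = contradiction (RightVeering-length rv) (<⇒≱ η<ν)

Comparable-sameLength : ∀ {ρ t ν} → Comparable (ρ ∷ʳ t) ν → length (ρ ∷ʳ t) ≡ length ν →
                        ∃[ j ] ν ≡ ρ ∷ʳ j
Comparable-sameLength {ρ} (inj₁ (ρ′ , _ , j , eq , _ , ρ′j⊴ν)) len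
  with refl , refl ← ∷ʳ-injective ρ ρ′ eq =
  j , sym (⊴-sameLength ρ′j⊴ν (trans (length-∷ʳ-cong ρ) len))
Comparable-sameLength {ρ} (inj₂ (ρ′ , t′ , j , refl , _ , ρ′j⊴ρt)) len =
  t′ , cong (_∷ʳ t′) (∷ʳ-injectiveˡ ρ′ ρ (⊴-sameLength ρ′j⊴ρt (trans (length-∷ʳ-cong ρ′) (sym len))))

sameLength-siblings : ∀ {ys v} → All (_≢ []) ys → AllPairs Comparable ys → All (λ y → length y ≡ v) ys →
                      ∃[ ρ ] All (λ y → ∃[ j ] y ≡ ρ ∷ʳ j) ys
sameLength-siblings [] [] [] = [] , []
sameLength-siblings {y ∷ _} (y≢[] ∷ _) (y~ys ∷ _) (y≡v ∷ ys≡v) with initLast y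
... | []      = ⊥-elim (y≢[] refl)
... | ρ ∷ʳ′ t = ρ , (t , refl) ∷ All.zipWith sibling (y~ys , ys≡v)
  where
    sibling : ∀ {z} → Comparable (ρ ∷ʳ t) z × length z ≡ _ → ∃[ j ] z ≡ ρ ∷ʳ j
    sibling (y~z , z≡v) = Comparable-sameLength y~z (trans y≡v (sym z≡v))

spread-leftLeaning : ∀ {η ν} → LeftLeaning η ν → StrictLeftLeaning (spread η) (spread ν)
spread-leftLeaning (ρ , t , j , refl , j≤t , s , s≢[] , refl) =
  map interior ρ , terminal t , interior j , spread-∷ʳ ρ t , interior<terminal j≤t ,
  spread s , spread-≢[] s≢[] , sym (spread-extension ρ j s≢[])

spread-rightVeering : ∀ {η ν} → RightVeering η ν → length η < length ν →
                      StrictRightVeering (spread η) (spread ν)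
spread-rightVeering (ρ , t , j , refl , t<j , [] , refl) η<ν =
  contradiction (trans (length-∷ʳ-cong ρ) (cong length (sym (++-identityʳ (ρ ∷ʳ j))))) (<⇒≢ η<ν)
spread-rightVeering (ρ , t , j , refl , t<j , s@(_ ∷ _) , refl) _ =
  map interior ρ , terminal t , interior j , spread-∷ʳ ρ t , terminal<interior t<j ,
  spread s , spread-≢[] (λ ()) , sym (spread-extension ρ j (λ ()))

idx-injective : ∀ {μ} {i j : Idx μ} → idx→ℕ {μ} i ≡ idx→ℕ {μ} j → i ≡ j
idx-injective {fin n} = Fin.toℕ-injective
idx-injective {ω}     = id

idx-below : ∀ {μ} (j : Idx μ) {m} → m < idx→ℕ {μ} j → Σ (Idx μ) λ i → idx→ℕ {μ} i ≡ m
idx-below {fin n} j m<j = fromℕ< (<-trans m<j (Fin.toℕ<n j)) , Fin.toℕ-fromℕ< _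
idx-below {ω}     j {m} _ = m , refl

module _ (E : Enumeration) (path : IsPath RightVeering E) where

  private
    ix : Idx (μ E) → ℕ
    ix = idx→ℕ {μ E}

  rightVeering-at-distance : ∀ d i j → ix j ≡ suc (d + ix i) → RightVeering (elt E i) (elt E j)
  rightVeering-at-distance zero    i j j≡1+i = path i j j≡1+i
  rightVeering-at-distance (suc d) i j j≡2+d+i with idx-below j (≤-reflexive (sym j≡2+d+i))
  ... | j′ , j′≡1+d+i =
    RightVeering-trans (rightVeering-at-distance d i j′ j′≡1+d+i)
                       (path j′ j (trans j≡2+d+i (cong suc (sym j′≡1+d+i))))

  rightVeering-< : ∀ i j → ix i < ix j → RightVeering (elt E i) (elt E j)
  rightVeering-< i j i<j =
    rightVeering-at-distance _ i j (sym (trans (sym (+-suc _ (ix i))) (m∸n+n≡m i<j)))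

  path-comparable : ∀ {i j} → i ≢ j → Comparable (elt E i) (elt E j)
  path-comparable {i} {j} i≢j with <-cmp (ix i) (ix j)
  ... | tri< i<j _ _ = inj₁ (rightVeering-< i j i<j)
  ... | tri≈ _ i≡j _ = contradiction (idx-injective {μ E} i≡j) i≢j
  ... | tri> _ _ j<i = inj₂ (rightVeering-< j i j<i)

module _ {A : Set} where

  lookup-injective : ∀ {xs : List A} → Unique xs → Injective _≡_ _≡_ (lookup xs)
  lookup-injective (_    ∷ _) {Fin.zero}  {Fin.zero}  _  = refl
  lookup-injective (x∉xs ∷ _) {Fin.zero}  {Fin.suc j} eq =
    contradiction eq (All.lookup x∉xs (∈-lookup j))
  lookup-injective (x∉xs ∷ _) {Fin.suc i} {Fin.zero}  eq =
    contradiction (sym eq) (All.lookup x∉xs (∈-lookup i))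
  lookup-injective (_    ∷ u) {Fin.suc i} {Fin.suc j} eq = cong Fin.suc (lookup-injective u eq)

  Linked-lookup : ∀ {R : A → A → Set} {xs} → Linked R xs →
                  ∀ i j → toℕ j ≡ suc (toℕ i) → R (lookup xs i) (lookup xs j)
  Linked-lookup (r ∷ _)  Fin.zero    (Fin.suc Fin.zero)    refl = r
  Linked-lookup (_ ∷ rs) (Fin.suc i) (Fin.suc j)           eq   = Linked-lookup rs i j (suc-injective eq)
  Linked-lookup [-]      Fin.zero    Fin.zero              ()
  Linked-lookup (_ ∷ _)  Fin.zero    Fin.zero              ()
  Linked-lookup (_ ∷ _)  Fin.zero    (Fin.suc (Fin.suc _)) ()
  Linked-lookup (_ ∷ _)  (Fin.suc _) Fin.zero              ()

  AllPairs-resp-⊆ : ∀ {R : A → A → Set} {xs ys} → xs ⊆ ys → AllPairs R ys → AllPairs R xs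
  AllPairs-resp-⊆ Sublist.[]          []       = []
  AllPairs-resp-⊆ (_    Sublist.∷ʳ τ) (_ ∷ rs) = AllPairs-resp-⊆ τ rs
  AllPairs-resp-⊆ (refl Sublist.∷  τ) (r ∷ rs) = All-resp-⊆ τ r ∷ AllPairs-resp-⊆ τ rs

  All-image⇒map : ∀ {B : Set} {f : B → A} {xs} → All (λ x → ∃[ y ] x ≡ f y) xs → ∃[ ys ] xs ≡ map f ys
  All-image⇒map []                = [] , refl
  All-image⇒map ((y , refl) ∷ ps) with ys , refl ← All-image⇒map ps = y ∷ ys , refl

length-filter+length-filter-∁ : ∀ {A : Set} {P : A → Set} (P? : Decidable P) xs →
  length (filter P? xs) + length (filter (∁? P?) xs) ≡ length xs
length-filter+length-filter-∁ P? []       = refl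
length-filter+length-filter-∁ P? (x ∷ xs) with P? x
... | yes _ = cong suc (length-filter+length-filter-∁ P? xs)
... | no  _ = trans (+-suc _ _) (cong suc (length-filter+length-filter-∁ P? xs))

module _ {A : Set} (key : A → ℕ) where

  private
    sameKey? : ∀ x → Decidable (λ y → key y ≡ key x)
    sameKey? x y = key y ≟ key x

    remaining-count : ∀ {a c s d} → a * suc c ≤ suc (s + d) → suc s < a → a * c ≤ d
    remaining-count {a} {c} {s} {d} a[1+c]≤ s<a = +-cancelˡ-≤ (suc s) _ _ (<⇒≤ (begin-strict
      suc s + a * c  <⟨ +-monoˡ-≤ (a * c) s<a ⟩
      a + a * c      ≡⟨ *-suc a c ⟨
      a * suc c      ≤⟨ a[1+c]≤ ⟩
      suc (s + d)    ∎))
      where open ≤-Reasoning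

  pigeonhole : ∀ a c (xs : List A) → a * c ≤ length xs →
    (∃[ ys ] ys ⊆ xs × a ≤ length ys × ∃[ v ] All (λ y → key y ≡ v) ys) ⊎
    (∃[ zs ] zs ⊆ xs × c ≤ length zs × AllPairs (λ y z → key y ≢ key z) zs)
  pigeonhole a zero    xs       _   = inj₂ ([] , Sublist.minimum xs , z≤n , [])
  pigeonhole a (suc c) []       a≤0 = inj₁ ([] , Sublist.[] , ≤-trans (m≤m*n a (suc c)) a≤0 , 0 , [])
  pigeonhole a (suc c) (x ∷ xs) a≤  with a ≤? suc (length (filter (sameKey? x) xs))
  ... | yes a≤same =
    inj₁ (x ∷ filter (sameKey? x) xs , refl Sublist.∷ filter-⊆ (sameKey? x) xs , a≤same ,
          key x , refl ∷ All.all-filter (sameKey? x) xs)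
  ... | no  a≰same
    with pigeonhole a c (filter (∁? (sameKey? x)) xs)
           (remaining-count
             (subst (a * suc c ≤_) (cong suc (sym (length-filter+length-filter-∁ (sameKey? x) xs))) a≤)
             (≰⇒> a≰same))
  ...   | inj₁ (ys , ys⊆ , a≤ys , v , same) =
          inj₁ (ys , x Sublist.∷ʳ ⊆-trans ys⊆ (filter-⊆ _ xs) , a≤ys , v , same)
  ...   | inj₂ (zs , zs⊆ , c≤zs , distinct) =
          inj₂ (x ∷ zs , refl Sublist.∷ ⊆-trans zs⊆ (filter-⊆ _ xs) , s≤s c≤zs ,
                All.map ≢-sym (All-resp-⊆ zs⊆ (All.all-filter _ xs)) ∷ distinct)

listEnumeration : (xs : List Seq) → Unique xs → All (_≢ []) xs → Enumeration
listEnumeration xs unique nonempty = record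
  { μ = fin (length xs) ; elt = lookup xs ; injec = lookup-injective unique
  ; nonempty = λ i → All.lookup nonempty (∈-lookup i) }

listEnumeration-isPath : ∀ {R xs} u ne → Linked R xs → IsPath R (listEnumeration xs u ne)
listEnumeration-isPath _ _ linked = Linked-lookup linked

childrenOf : Seq → Enumeration
childrenOf ρ = record
  { μ = ω ; elt = ρ ∷ʳ_ ; injec = ∷ʳ-injectiveʳ ρ ρ ; nonempty = ∷ʳ-≢[] ρ }

childrenOf-isPath : ∀ ρ → IsPath DirectSibling (childrenOf ρ)
childrenOf-isPath ρ i j j≡1+i = ρ , i , j , refl , ≤-reflexive (sym j≡1+i) , refl

module _ {L : Language} (N : Structure L) {nx ny : ℕ} (φ : Formula L (nx + ny))
         (a : Seq → Fin ny → Structure.Carrier N) {k : ℕ} where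

  KInconsistentOn⇒¬All : ∀ {E} → KInconsistentOn N φ a k E →
    (is : List (Idx (μ E))) → Unique is → k ≤ length is →
    ∀ b → ¬ All (λ i → Realises N φ a b (elt E i)) is
  KInconsistentOn⇒¬All inconsistent is unique k≤ b realised =
    inconsistent (λ l → lookup is (inject≤ l k≤))
      (Fin.inject≤-injective k≤ k≤ _ _ ∘ lookup-injective unique)
      b (λ l → All.lookup realised (∈-lookup (inject≤ l k≤)))

  KInconsistentOn⇒¬All-list : ∀ {xs} u ne → KInconsistentOn N φ a k (listEnumeration xs u ne) →
    k ≤ length xs → ∀ b → ¬ All (Realises N φ a b) xs
  KInconsistentOn⇒¬All-list {xs} u ne inconsistent k≤ b realised =
    KInconsistentOn⇒¬All {listEnumeration xs u ne} inconsistent (allFin (length xs)) (Unique.allFin⁺ _)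
      (subst (k ≤_) (sym (length-tabulate id)) k≤) b
      (All.tabulate⁺ (λ i → All.lookup realised (∈-lookup i)))

spreadEnumeration : Enumeration → Enumeration
spreadEnumeration E = record
  { μ = μ E ; elt = spread ∘ elt E ; injec = injec E ∘ spread-injective
  ; nonempty = spread-≢[] ∘ nonempty E }

module _ {L : Language} (N : Structure L) {nx ny : ℕ} (φ : Formula L (nx + ny))
         (a : Seq → Fin ny → Structure.Carrier N) {k : ℕ}
         (strictRightVeering-inconsistent : ∀ E → IsPath StrictRightVeering E → KInconsistentOn N φ a k E)
         (directSibling-inconsistent      : ∀ E → IsPath DirectSibling E → KInconsistentOn N φ a k E)
         where

  module _ (b : Fin nx → Structure.Carrier N) where

    private
      SpreadRealised : Seq → Set
      SpreadRealised η = Realises N φ a b (spread η)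

    children-unrealisable : ∀ ρ ts → k ≤ length ts → Unique ts → ¬ All (SpreadRealised ∘ (ρ ∷ʳ_)) ts
    children-unrealisable ρ ts k≤ distinct realised =
      KInconsistentOn⇒¬All N φ a {E = childrenOf ρ′}
        (directSibling-inconsistent (childrenOf ρ′) (childrenOf-isPath ρ′))
        (map terminal ts) (Unique.map⁺ terminal-injective distinct)
        (subst (k ≤_) (sym (length-map terminal ts)) k≤) b
        (All.map⁺ (All.map (subst (Realises N φ a b) (spread-∷ʳ ρ _)) realised))
      where ρ′ = map interior ρ

    siblings-unrealisable : ∀ {ys v} → k ≤ length ys → All (_≢ []) ys → AllPairs Comparable ys →
                            All (λ y → length y ≡ v) ys → ¬ All SpreadRealised ys
    siblings-unrealisable k≤ nonempty comparable sameLength realised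
      with ρ , siblings ← sameLength-siblings nonempty comparable sameLength
      with ts , refl ← All-image⇒map siblings =
      children-unrealisable ρ ts (subst (k ≤_) (length-map _ ts) k≤)
        (Unique.map⁻ (AllPairs.map Comparable⇒≢ comparable)) (All.map⁻ realised)

    chain-unrealisable : ∀ {zs} → k ≤ length zs → All (_≢ []) zs →
                         AllPairs (λ η ν → Comparable η ν × length η ≢ length ν) zs →
                         ¬ All SpreadRealised zs
    chain-unrealisable {zs} k≤ nonempty separated realised =
      KInconsistentOn⇒¬All-list N φ a distinct nonempty′
        (strictRightVeering-inconsistent (listEnumeration (map spread ws) distinct nonempty′)
                                         (listEnumeration-isPath distinct nonempty′ linked))
        (subst (k ≤_) (trans (↭-length zs↭ws) (sym (length-map spread ws))) k≤) b
        (All.map⁺ (All-resp-↭ zs↭ws realised))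
      where
        ws = sort zs
        zs↭ws : zs ↭ ws
        zs↭ws = ↭-sym (sort-↭ zs)
        separated′ : AllPairs (λ η ν → Comparable η ν × length η ≢ length ν) ws
        separated′ = AllPairs-resp-↭ (Product.map Comparable-sym ≢-sym) (resp₂ _) (↭⇒↭ₛ zs↭ws) separated
        linked : Linked StrictRightVeering (map spread ws)
        linked = Linked.map⁺ (Linked.zipWith
          (λ (η≤ν , η~ν , η≢ν) → let η<ν = ≤∧≢⇒< η≤ν η≢ν in
                                  spread-rightVeering (Comparable-shorter η~ν η<ν) η<ν)
          (sort-↗ zs , Linked.AllPairs⇒Linked separated′))
        distinct : Unique (map spread ws)
        distinct = Unique.map⁺ spread-injective (AllPairs.map (Comparable⇒≢ ∘ proj₁) separated′)
        nonempty′ : All (_≢ []) (map spread ws)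
        nonempty′ = All.map⁺ (All.map spread-≢[] (All-resp-↭ zs↭ws nonempty))

    comparable-unrealisable : ∀ {xs} → k * k ≤ length xs → All (_≢ []) xs → AllPairs Comparable xs →
                              ¬ All SpreadRealised xs
    comparable-unrealisable k²≤ nonempty comparable realised with pigeonhole length k k _ k²≤
    ... | inj₁ (ys , ys⊆ , k≤ , _ , sameLength) =
      siblings-unrealisable k≤ (All-resp-⊆ ys⊆ nonempty) (AllPairs-resp-⊆ ys⊆ comparable) sameLength
        (All-resp-⊆ ys⊆ realised)
    ... | inj₂ (zs , zs⊆ , k≤ , distinctLength) =
      chain-unrealisable k≤ (All-resp-⊆ zs⊆ nonempty)
        (AllPairs.zip (AllPairs-resp-⊆ zs⊆ comparable , distinctLength)) (All-resp-⊆ zs⊆ realised)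

  rightVeering-spread-inconsistent : ∀ E → IsPath RightVeering E →
                                     KInconsistentOn N φ (a ∘ spread) (k * k) E
  rightVeering-spread-inconsistent E path f f-injective b realised =
    comparable-unrealisable b (≤-reflexive (sym (length-tabulate _)))
      (All.tabulate⁺ (nonempty E ∘ f))
      (AllPairs.tabulate⁺ (λ l≢m → path-comparable E path (l≢m ∘ f-injective)))
      (All.tabulate⁺ realised)

BTP⇒StrictBTP : {L : Language} (T : Theory L) → HasBTP T → StrictBTPWitness T
BTP⇒StrictBTP T (N , model , nx , ny , φ , a , k , leftLeaning , rightVeering) =
  N , model , nx , ny , φ , a , k ,
  (λ E path → leftLeaning E (λ i j j≡1+i → strictLeftLeaning⇒leftLeaning (path i j j≡1+i))) ,
  (λ E path → rightVeering E (λ i j j≡1+i → strictRightVeering⇒rightVeering (path i j j≡1+i))) ,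
  (λ E path → rightVeering E (λ i j j≡1+i → directSibling⇒rightVeering (path i j j≡1+i)))

StrictBTP⇒BTP : {L : Language} (T : Theory L) → StrictBTPWitness T → HasBTP T
StrictBTP⇒BTP T (N , model , nx , ny , φ , a , k , strictLeftLeaning , strictRightVeering , siblings) =
  N , model , nx , ny , φ , a ∘ spread , k * k ,
  (λ E path → strictLeftLeaning (spreadEnumeration E)
                 (λ i j j≡1+i → spread-leftLeaning (path i j j≡1+i))) ,
  rightVeering-spread-inconsistent N φ a strictRightVeering siblings

lemmaC : {L : Language} (T : Theory L) → Complete T →
    (HasBTP T → StrictBTPWitness T) × (StrictBTPWitness T → HasBTP T)
lemmaC T _ = BTP⇒StrictBTP T , StrictBTP⇒BTP T
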